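{- Let $G=(V,E)$ be a $k$-outerplanar graph with a $k$-outerplanar embedding, let $V_1,\dots,V_k$ be its stripping layers, and let $v\in V_i$. Each face $f$ incident to $v$ has layer number $i$ or $i-1$. Furthermore, $f$ has layer number $i-1$ if the boundary of $f$ contains a vertex $w$ with $w\in V_{i-1}$.
   Context: Graphs are finite, simple, undirected and connected. A planar embedding is $1$-outerplanar if all vertices lie on the outer face; for $k\ge 2$ it is $k$-outerplanar if deleting the outer-face vertices yields a $(k-1)$-outerplanar embedding. The stripping layers: removing all vertices on the outer face is a stripping step; the set removed in the $i$-th repeated step is $V_i$. Layer numbers of faces of the embedding: the outer face has layer number $0$; every other face has layer number one more than the minimum layer number of its adjacent faces, where two faces are adjacent if they share an incident vertex. -}

module Defs where

open import Data.Nat using (ℕ; zero; suc; _+_; _*_; _≤_; _<_)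
open import Data.Nat.DivMod using (_%_; m%n<n)
open import Data.Fin using (Fin; toℕ; fromℕ<)
open import Data.List using (List; length; lookup; map; allFin)
open import Data.Nat.ListAction using (sum)
open import Data.List.Membership.Propositional using (_∈_)
open import Data.List.Membership.Propositional.Properties using (∈-lookup)
open import Data.List.Relation.Unary.Any using (index)
open import Data.List.Relation.Unary.Unique.Propositional using (Unique)
open import Data.Product using (Σ; ∃; _×_; _,_; proj₁)
open import Data.Sum using (_⊎_)
open import Data.Empty using (⊥)
open import Relation.Nullary using (¬_)
open import Relation.Binary.PropositionalEquality using (_≡_)
open import Relation.Binary.Construct.Closure.ReflexiveTransitive using (Star)

csuc : ∀ {k} → Fin k → Fin k
csuc {suc k} i = fromℕ< (m%n<n (suc (toℕ i)) (suc k))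

iter : ∀ {A : Set} → (A → A) → ℕ → A → A
iter f zero    a = a
iter f (suc j) a = f (iter f j a)

-- A finite simple connected graph on vertex set Fin n, together with a
-- rotation system: ρ u lists the neighbours of u in cyclic (clockwise)
-- order around u.  Adjacency is  w ∈ ρ u.

record RotationSystem : Set where
  field
    n         : ℕ
    ρ         : Fin n → List (Fin n)
    unique    : ∀ u → Unique (ρ u)
    loopless  : ∀ u → ¬ (u ∈ ρ u)
    symm      : ∀ u w → w ∈ ρ u → u ∈ ρ w
    connected : ∀ u w → Star (λ a b → b ∈ ρ a) u w

module _ (R : RotationSystem) where
  open RotationSystem R

  -- darts (directed edges) u → (ρ u)[p]
  Dart : Set
  Dart = Σ (Fin n) (λ u → Fin (length (ρ u)))

  tail : Dart → Fin n
  tail = proj₁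

  headOf : Dart → Fin n
  headOf (u , p) = lookup (ρ u) p

  -- face-tracing permutation: (u → w) ↦ (w → successor of u in ρ w)
  φ : Dart → Dart
  φ (u , p) = lookup (ρ u) p , csuc (index (symm u (lookup (ρ u) p) (∈-lookup p)))

  SameFace : Dart → Dart → Set
  SameFace d e = ∃ λ j → iter φ j d ≡ e

  -- number of darts = 2 |E|
  numDarts : ℕ
  numDarts = sum (map (λ u → length (ρ u)) (allFin n))

-- A plane embedding: the rotation system has genus 0 (Euler's formula
-- |V| - |E| + |F| = 2, with F the number of face orbits), and one face is
-- designated as the outer face.

record PlaneEmbedding (R : RotationSystem) : Set where
  open RotationSystem R
  field
    F            : ℕ
    faceOf       : Dart R → Fin F
    faceOf-surj  : ∀ f → ∃ λ d → faceOf d ≡ f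
    faceOf-sound : ∀ d e → faceOf d ≡ faceOf e → SameFace R d e
    faceOf-compl : ∀ d e → SameFace R d e → faceOf d ≡ faceOf e
    euler        : 2 * n + 2 * F ≡ 4 + numDarts R
    outer        : Fin F

module _ {R : RotationSystem} (E : PlaneEmbedding R) where
  open RotationSystem R
  open PlaneEmbedding E

  Face : Set
  Face = Fin F

  Incident : Fin n → Face → Set
  Incident v f = ∃ λ (d : Dart R) → tail R d ≡ v × faceOf d ≡ f

  Adjacent : Face → Face → Set
  Adjacent f g = ¬ (f ≡ g) × ∃ λ v → Incident v f × Incident v g

  -- L satisfies the defining equations of layer numbers of faces:
  -- outer face has 0, any other face has 1 + min over adjacent faces.
  IsLayerNumbering : (Face → ℕ) → Set
  IsLayerNumbering L =
    L outer ≡ 0 ×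
    (∀ f → ¬ (f ≡ outer) →
       (∃ λ g → Adjacent f g × L f ≡ suc (L g)) ×
       (∀ g → Adjacent f g → L f ≤ suc (L g)))

  -- Gone i v : v ∈ V₁ ∪ … ∪ Vᵢ.
  -- After deleting V₁ ∪ … ∪ Vᵢ, two faces of G lie in the same face
  -- (region) of the remaining plane graph iff they are linked by a chain
  -- of faces consecutive ones sharing a deleted vertex (MergeAt i).
  -- OnOuter i v : v is on the boundary of the outer region of G - (V₁∪…∪Vᵢ).
  Gone : ℕ → Fin n → Set

  MergeAt : ℕ → Face → Face → Set
  MergeAt i f g = ∃ λ w → Gone i w × Incident w f × Incident w g

  OnOuter : ℕ → Fin n → Set
  OnOuter i v = ∃ λ g → Incident v g × Star (MergeAt i) outer g

  Gone zero    v = ⊥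
  Gone (suc i) v = Gone i v ⊎ (¬ Gone i v × OnOuter i v)

  -- InLayer i v : v ∈ Vᵢ  (i ≥ 1)
  InLayer : ℕ → Fin n → Set
  InLayer zero    v = ⊥
  InLayer (suc i) v = ¬ Gone i v × OnOuter i v

  KOuterplanar : ℕ → Set
  KOuterplanar k = ∀ v → Gone k v

module Submission where

open import Defs
open import Data.Nat using (ℕ; zero; suc; _∸_; _≤_; _<_; z≤n; s≤s)
open import Data.Nat.Properties
  using (≤-trans; ≤-reflexive; ≤-antisym; n≤1+n; m<n⇒m<1+n; suc-injective; ≮⇒≥; m≤n⇒m<n∨m≡n)
open import Data.Fin using (Fin; _≟_)
open import Data.Sum using (_⊎_; inj₁; inj₂)
open import Data.Product using (_×_; _,_; proj₁; proj₂; ∃)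
open import Function using (id)
open import Relation.Nullary using (¬_; yes; no)
open import Relation.Nullary.Negation using (DoubleNegation)
open import Relation.Binary.PropositionalEquality using (_≡_; refl; sym; trans; subst)
open import Relation.Binary.Construct.Closure.ReflexiveTransitive
  using (Star; ε; _◅_; _◅◅_; gmap)

-- Layer numbers change by at most one across a shared vertex, so a face next to a
-- vertex removed in step i has layer number below i; this gives the upper bounds.
-- Conversely every face of layer number m is linked to the outer face through
-- vertices of V₁ ∪ … ∪ Vₘ (follow the faces of decreasing layer number), so all its
-- vertices are gone after step m + 1; this gives the lower bound.  The latter is
-- only obtained up to double negation, which suffices for a goal j ≤ L f.

module Stripping {R : RotationSystem} (E : PlaneEmbedding R) where
  open PlaneEmbedding E

  Gone-suc : ∀ {j w} → Gone E j w → Gone E (suc j) w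
  Gone-suc = inj₁

  Gone-mono : ∀ {j j′ w} → j ≤ j′ → Gone E j w → Gone E j′ w
  Gone-mono {j} {j′} j≤j′ gw with m≤n⇒m<n∨m≡n j≤j′
  Gone-mono {j′ = suc j′} _ gw | inj₁ (s≤s j≤j′) = Gone-suc (Gone-mono j≤j′ gw)
  ... | inj₂ refl = gw

  reached-suc : ∀ {j f g} → Star (MergeAt E j) f g → Star (MergeAt E (suc j)) f g
  reached-suc = gmap id λ (w , gw , w∈f , w∈g) → w , Gone-suc gw , w∈f , w∈g

  Gone-suc-if-reached : ∀ {j g w} → Star (MergeAt E j) outer g → Incident E w g
                      → DoubleNegation (Gone E (suc j) w)
  Gone-suc-if-reached reached w∈g ¬gone =
    ¬gone (inj₂ ((λ gw → ¬gone (inj₁ gw)) , _ , w∈g , reached))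

module Layers {R : RotationSystem} (E : PlaneEmbedding R) (L : Face E → ℕ)
              (isLayer : IsLayerNumbering E L) where
  open PlaneEmbedding E
  open Stripping E

  L-outer : L outer ≡ 0
  L-outer = proj₁ isLayer

  L-shared-vertex : ∀ {v f g} → Incident E v f → Incident E v g → L f ≤ suc (L g)
  L-shared-vertex {v} {f} {g} v∈f v∈g with f ≟ outer | f ≟ g
  ... | yes refl | _        = ≤-trans (≤-reflexive L-outer) z≤n
  ... | no _     | yes refl = n≤1+n (L f)
  ... | no f≢o   | no f≢g   = proj₂ (proj₂ isLayer f f≢o) g (f≢g , v , v∈f , v∈g)

  mutual
    Gone⇒low-face : ∀ {j w} → Gone E j w → ∃ λ h → Incident E w h × L h < j
    Gone⇒low-face {zero} ()
    Gone⇒low-face {suc j} (inj₁ gw) with Gone⇒low-face gw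
    ... | h , w∈h , lt = h , w∈h , m<n⇒m<1+n lt
    Gone⇒low-face {suc j} (inj₂ (_ , on)) with OnOuter⇒low-face on
    ... | h , w∈h , le = h , w∈h , s≤s le

    OnOuter⇒low-face : ∀ {j v} → OnOuter E j v → ∃ λ g → Incident E v g × L g ≤ j
    OnOuter⇒low-face (g , v∈g , reached) =
      g , v∈g , reached⇒L≤ reached (≤-trans (≤-reflexive L-outer) z≤n)

    reached⇒L≤ : ∀ {j f g} → Star (MergeAt E j) f g → L f ≤ j → L g ≤ j
    reached⇒L≤ ε                             le = le
    reached⇒L≤ ((w , gw , _ , w∈g) ◅ merges) _  with Gone⇒low-face gw
    ... | h , w∈h , lt = reached⇒L≤ merges (≤-trans (L-shared-vertex w∈g w∈h) lt)

  InLayer⇒L≤ : ∀ {j w f} → InLayer E j w → Incident E w f → L f ≤ j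
  InLayer⇒L≤ {suc j} (_ , on) w∈f with OnOuter⇒low-face on
  ... | g , w∈g , le = ≤-trans (L-shared-vertex w∈f w∈g) (s≤s le)

  L≡0⇒outer : ∀ {h} → L h ≡ 0 → h ≡ outer
  L≡0⇒outer {h} Lh≡0 with h ≟ outer
  ... | yes h≡o = h≡o
  ... | no h≢o with proj₁ (proj₂ isLayer h h≢o)
  ...   | _ , _ , Lh≡1+Lg with trans (sym Lh≡0) Lh≡1+Lg
  ...     | ()

  reached-at-layer : ∀ m {h} → L h ≡ m → DoubleNegation (Star (MergeAt E m) outer h)
  reached-at-layer zero Lh≡0 ¬reached =
    ¬reached (subst (Star (MergeAt E 0) outer) (sym (L≡0⇒outer Lh≡0)) ε)
  reached-at-layer (suc m) {h} Lh≡1+m with h ≟ outer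
  ... | yes refl = λ ¬reached → ¬reached ε
  ... | no h≢o with proj₁ (proj₂ isLayer h h≢o)
  ...   | g , (_ , w , w∈h , w∈g) , Lh≡1+Lg = λ ¬reached →
    reached-at-layer m Lg≡m λ reached →
      Gone-suc-if-reached reached w∈g λ gw →
        ¬reached (reached-suc reached ◅◅ ((w , gw , w∈g , w∈h) ◅ ε))
    where
    Lg≡m : L g ≡ m
    Lg≡m = suc-injective (trans (sym Lh≡1+Lg) Lh≡1+m)

  ¬Gone⇒≤L : ∀ {j v f} → ¬ Gone E j v → Incident E v f → j ≤ L f
  ¬Gone⇒≤L {zero}          _     _   = z≤n
  ¬Gone⇒≤L {suc j} {v} {f} ¬gone v∈f = ≮⇒≥ λ { (s≤s Lf≤j) →
    reached-at-layer (L f) refl λ reached →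
      Gone-suc-if-reached reached v∈f λ gv → ¬gone (Gone-mono (s≤s Lf≤j) gv) }

proposition2 : (R : RotationSystem) (E : PlaneEmbedding R) (k : ℕ)
    → KOuterplanar E k
    → (L : Face E → ℕ) → IsLayerNumbering E L
    → (i : ℕ) (v : Fin (RotationSystem.n R)) → InLayer E i v
    → (f : Face E) → Incident E v f
    → (L f ≡ i ⊎ L f ≡ i ∸ 1)
    × ((w : Fin (RotationSystem.n R)) → Incident E w f → InLayer E (i ∸ 1) w → L f ≡ i ∸ 1)
proposition2 R E _ _ L isLayer (suc i) v v-layer f v∈f = L-cases , L-at-lower-vertex
  where
  open Layers E L isLayer
  lower : i ≤ L f
  lower = ¬Gone⇒≤L (proj₁ v-layer) v∈f
  L-cases : L f ≡ suc i ⊎ L f ≡ i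
  L-cases with m≤n⇒m<n∨m≡n (InLayer⇒L≤ v-layer v∈f)
  ... | inj₁ (s≤s Lf≤i) = inj₂ (≤-antisym Lf≤i lower)
  ... | inj₂ Lf≡1+i     = inj₁ Lf≡1+i
  L-at-lower-vertex : ∀ w → Incident E w f → InLayer E i w → L f ≡ i
  L-at-lower-vertex w w∈f w∈Vᵢ₋₁ = ≤-antisym (InLayer⇒L≤ w∈Vᵢ₋₁ w∈f) lower
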